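{- Let $q$ be a prime power. The number of equivalence classes, under dynamical equivalence, of the dynamical systems $(\mathbb{F}_q, x\mapsto ax+b)$ with $a\in\mathbb{F}_q^*$ and $b\in\mathbb{F}_q$ is equal to $\tau(q-1)+1$, where $\tau(q-1)$ is the number of distinct positive divisors of $q-1$.
   Context: Two dynamical systems $(\mathbb{S},f)$ and $(\mathbb{T},g)$ (maps $f:\mathbb{S}\to\mathbb{S}$, $g:\mathbb{T}\to\mathbb{T}$) are dynamically equivalent if there is a bijection $\sigma:\mathbb{S}\to\mathbb{T}$ with $\sigma^{ -1}\circ g\circ\sigma=f$. $\mathbb{F}_q^*=\mathbb{F}_q\setminus\{0\}$. -}

module Defs where

open import Level using (Level; _⊔_)
open import Data.Nat using (ℕ; suc; _∸_)
open import Data.Nat.Divisibility using (_∣?_)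
open import Data.List using (length; filter; map; upTo)
open import Data.Fin using (Fin)
open import Data.Product using (Σ; ∃; _×_)
open import Relation.Nullary using (¬_)
open import Relation.Binary.PropositionalEquality using (_≡_)
import Relation.Binary.PropositionalEquality as ≡
open import Relation.Binary using (Setoid)
open import Algebra.Bundles using (CommutativeRing)
open import Function.Bundles using (Bijection; Inverse)

private variable c ℓ a ℓa : Level

record IsField (R : CommutativeRing c ℓ) : Set (c ⊔ ℓ) where
  open CommutativeRing R
  field
    0≉1     : ¬ (0# ≈ 1#)
    inverse : ∀ x → ¬ (x ≈ 0#) → ∃ λ y → (x * y) ≈ 1#

HasOrder : CommutativeRing c ℓ → ℕ → Set (c ⊔ ℓ)
HasOrder R q = Inverse (CommutativeRing.setoid R) (≡.setoid (Fin q))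

-- Dynamical equivalence of (S,f) and (S,g): a bijection σ : S → S with σ⁻¹ ∘ g ∘ σ = f,
-- i.e. g (σ x) = σ (f x) for all x.
DynEquiv : (S : Setoid a ℓa) → (Setoid.Carrier S → Setoid.Carrier S)
         → (Setoid.Carrier S → Setoid.Carrier S) → Set (a ⊔ ℓa)
DynEquiv S f g = Σ (Bijection S S) λ σ →
  ∀ x → Setoid._≈_ S (Bijection.to σ (f x)) (g (Bijection.to σ x))

HasNClasses : ∀ {p r} (P : Set p) → (P → P → Set r) → ℕ → Set (p ⊔ r)
HasNClasses P _~_ n = Σ (Fin n → P) λ rep →
  (∀ i j → rep i ~ rep j → i ≡ j) × (∀ x → ∃ λ i → x ~ rep i)

τ : ℕ → ℕ
τ n = length (filter (_∣? n) (map suc (upTo n)))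

module AffineSystems (R : CommutativeRing c ℓ) where
  open CommutativeRing R
  Param : Set (c ⊔ ℓ)
  Param = Σ Carrier λ a → ¬ (a ≈ 0#) × Carrier

  affine : Param → Carrier → Carrier
  affine (a Data.Product., _ Data.Product., b) x = (a * x) + b

  _~_ : Param → Param → Set (c ⊔ ℓ)
  p ~ p' = DynEquiv setoid (affine p) (affine p')

module Submission where

-- If a ≠ 1 or b = 0, shifting x by a suitable constant conjugates x ↦ a x + b to
-- the scaling x ↦ a x; if a = 1 and b ≠ 0, rescaling conjugates it to x ↦ x + 1.  The
-- translation x ↦ x + 1 has no fixed point while scalings fix 0, so it forms its own class.
-- The multiplicative order of a is a conjugacy invariant of x ↦ a x, and conversely two
-- scalings whose multipliers have the same order d are conjugate by a power map x ↦ x ^ w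
-- with w a unit modulo n.  Since F* is cyclic of order n, the possible orders are exactly
-- the divisors of n, which gives τ(n) scaling classes.

open import Defs
open import Level using (Level)
open import Algebra.Bundles using (CommutativeRing)
open import Data.Nat.Base as ℕ using (ℕ; zero; suc; z≤n; s≤s)
import Data.Nat.Properties as ℕ
open import Data.Nat.Divisibility
  using (_∣_; _∣?_; divides; ∣-antisym; ∣⇒≤; *-cancelˡ-∣; m∣m*n; n∣m*n; 1∣_; 0∣⇒≡0)
open import Data.Nat.DivMod using (_%_; _/_; m%n<n; m≡m%n+[m/n]*n)
open import Data.Nat.Coprimality as Coprimality using (Coprime; coprime-divisor)
open import Data.Nat.Primality using (Prime)
open import Data.Nat.Tactic.RingSolver using (solve-∀)
open import Data.Fin.Base as Fin using (Fin; toℕ; punchIn; splitAt; join)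
import Data.Fin.Properties as Fin
open import Data.List.Base using (List; []; _∷_; length; replicate; lookup; filter; map; upTo)
open import Data.List.Properties using (length-replicate)
import Data.List.Relation.Unary.All as All
open import Data.List.Relation.Unary.All.Properties using (all-filter)
open import Data.List.Relation.Unary.AllPairs using (_∷_)
import Data.List.Relation.Unary.Any as Any
open import Data.List.Relation.Unary.Any.Properties using (lookup-index)
open import Data.List.Relation.Unary.Unique.Propositional using (Unique)
import Data.List.Relation.Unary.Unique.Propositional.Properties as Unique
open import Data.List.Membership.Propositional using (_∈_)
open import Data.List.Membership.Propositional.Properties using (∈-lookup; ∈-filter⁺; ∈-map⁺; ∈-upTo⁺)
open import Data.Product using (∃; ∃₂; _×_; _,_; proj₁; proj₂)
open import Data.Sum using (_⊎_; inj₁; inj₂)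
open import Data.Empty using (⊥-elim)
open import Function.Base using (_∘_)
open import Function.Bundles using (Bijection; Inverse)
open import Function.Properties.Inverse using (Inverse⇒Bijection)
import Function.Construct.Composition as Compose
open import Relation.Binary.Bundles using (Setoid)
open import Relation.Binary.Definitions using (Decidable)
open import Relation.Nullary using (¬_; Dec; yes; no)
open import Relation.Nullary.Decidable using (map′)
open import Relation.Binary.PropositionalEquality as ≡ using (_≡_; _≢_)

-- Elementary number theory in ℕ.
module Arithmetic where
  open import Data.Nat.Base
  open import Data.Nat.Properties
  open import Data.Nat.Divisibility
  open import Data.Nat.Coprimality using (coprime-Bézout; gcd≡1⇒coprime)
  open import Data.Nat.GCD using (gcd; gcd[m,n]∣m; gcd[m,n]∣n; gcd[m,n]≡0⇒m≡0; module Bézout)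
  open import Data.Nat.Primality using (prime⇒nonTrivial; prime⇒nonZero; prime⇒irreducible; euclidsLemma)
  open import Data.Nat.Primality.Factorisation using (factorise)
  open import Data.Nat.Induction using (<-rec)
  open import Data.Nat.ListAction using (product)
  open import Data.List.Relation.Unary.All using (_∷_)
  open import Relation.Binary.PropositionalEquality

  leastWitness : ∀ {p} {P : ℕ → Set p} → (∀ n → Dec (P n)) → ∀ {n} → P n →
                 ∃ λ m → P m × (∀ {k} → k < m → ¬ P k)
  leastWitness {P = P} P? {n} Pn = search n 0 (λ ()) Pn
    where
    search : ∀ fuel k → (∀ {i} → i < k → ¬ P i) → P (k + fuel) →
             ∃ λ m → P m × (∀ {i} → i < m → ¬ P i)
    search fuel k below P[k+fuel] with P? k
    ... | yes Pk = k , Pk , below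
    search zero k below P[k+0] | no ¬Pk = ⊥-elim (¬Pk (subst P (+-identityʳ k) P[k+0]))
    search (suc fuel) k below P[k+1+fuel] | no ¬Pk =
      search fuel (suc k) below′ (subst P (+-suc k fuel) P[k+1+fuel])
      where
      below′ : ∀ {i} → i < suc k → ¬ P i
      below′ i<1+k with m<1+n⇒m<n∨m≡n i<1+k
      ... | inj₁ i<k = below i<k
      ... | inj₂ refl = ¬Pk

  prime>1 : ∀ {p} → Prime p → 1 < p
  prime>1 {p} pp = nonTrivial⇒n>1 p {{prime⇒nonTrivial pp}}

  prime≢1 : ∀ {p} → Prime p → p ≢ 1
  prime≢1 pp p≡1 = <-irrefl (sym p≡1) (prime>1 pp)

  prime∤1 : ∀ {p} → Prime p → ¬ p ∣ 1
  prime∤1 pp p∣1 = prime≢1 pp (∣1⇒≡1 p∣1)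

  primeFactor : ∀ n → 1 < n → ∃ λ p → Prime p × p ∣ n
  primeFactor (suc zero) (s≤s ())
  primeFactor n@(suc (suc _)) _ with factorise n
  ... | record { factors = [] ; isFactorisation = () }
  ... | record { factors = p ∷ ps ; isFactorisation = eq ; factorsPrime = pp ∷ _ } =
    p , pp , divides (product ps) (trans eq (*-comm p (product ps)))

  coprimeByPrimes : ∀ {m n} → n ≢ 0 → (∀ p → Prime p → p ∣ m → ¬ p ∣ n) → Coprime m n
  coprimeByPrimes n≢0 _ {zero} (_ , 0∣n) = ⊥-elim (n≢0 (0∣⇒≡0 0∣n))
  coprimeByPrimes _ _ {suc zero} _ = refl
  coprimeByPrimes _ noCommon {d@(suc (suc _))} (d∣m , d∣n) with primeFactor d (s≤s (s≤s z≤n))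
  ... | p , pp , p∣d = ⊥-elim (noCommon p pp (∣-trans p∣d d∣m) (∣-trans p∣d d∣n))

  primeDivPow : ∀ {r p} → Prime r → ∀ j → r ∣ p ^ j → r ∣ p
  primeDivPow rr zero r∣1 = ⊥-elim (prime∤1 rr r∣1)
  primeDivPow {r} {p} rr (suc j) r∣p^sj with euclidsLemma p (p ^ j) rr r∣p^sj
  ... | inj₁ r∣p = r∣p
  ... | inj₂ r∣p^j = primeDivPow rr j r∣p^j

  coprimePrimePower : ∀ {p m} → Prime p → ¬ p ∣ m → ∀ j → Coprime (p ^ j) m
  coprimePrimePower {p} {m} pp p∤m j (e∣p^j , e∣m) =
    coprimeByPrimes (≢-nonZero⁻¹ (p ^ j) {{m^n≢0 p j {{prime⇒nonZero pp}}}}) onlyP (e∣m , e∣p^j)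
    where
    onlyP : ∀ r → Prime r → r ∣ m → ¬ r ∣ p ^ j
    onlyP r rr r∣m r∣p^j with prime⇒irreducible pp (primeDivPow rr j r∣p^j)
    ... | inj₁ refl = prime≢1 rr refl
    ... | inj₂ refl = p∤m r∣m

  primePowerSplit : ∀ {p} → Prime p → ∀ m → m ≢ 0 → ∃₂ λ s m₀ → m ≡ p ^ s * m₀ × ¬ p ∣ m₀
  primePowerSplit {p} pp = <-rec Split step
    where
    Split : ℕ → Set
    Split m = m ≢ 0 → ∃₂ λ s m₀ → m ≡ p ^ s * m₀ × ¬ p ∣ m₀
    step : ∀ m → (∀ {k} → k < m → Split k) → Split m
    step m rec m≢0 with p ∣? m
    ... | no p∤m = 0 , m , sym (+-identityʳ m) , p∤m
    ... | yes (divides zero m≡0) = ⊥-elim (m≢0 m≡0)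
    ... | yes (divides k@(suc _) m≡k*p) with rec k<m (λ ())
      where
      k<m : k < m
      k<m = subst (k <_) (sym m≡k*p) (m<m*n k p (prime>1 pp))
    ... | s , m₀ , k≡ , p∤m₀ = suc s , m₀ , m≡ , p∤m₀
      where
      m≡ : m ≡ p ^ suc s * m₀
      m≡ = begin
        m               ≡⟨ m≡k*p ⟩
        k * p           ≡⟨ cong (_* p) k≡ ⟩
        p ^ s * m₀ * p  ≡⟨ regroup (p ^ s) m₀ p ⟩
        p * p ^ s * m₀  ∎
        where
        open ≡-Reasoning
        regroup : ∀ a b c → a * b * c ≡ c * a * b
        regroup = solve-∀

  coprimeToPrime : ∀ {p m} → Prime p → ¬ p ∣ m → Coprime m p
  coprimeToPrime pp p∤m (e∣m , e∣p) with prime⇒irreducible pp e∣p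
  ... | inj₁ e≡1 = e≡1
  ... | inj₂ refl = ⊥-elim (p∤m e∣m)

  divisorOfPrimePower : ∀ {p} → Prime p → ∀ s D → D ∣ p ^ suc s → ¬ D ∣ p ^ s → D ≡ p ^ suc s
  divisorOfPrimePower {p} pp s D D∣ D∤ with p ∣? D
  ... | no p∤D = ⊥-elim (D∤ (coprime-divisor (coprimeToPrime pp p∤D) D∣))
  ... | yes (divides D′ D≡D′*p) = trans D≡D′*p (trans (cong (_* p) (D′≡ s D′∣ D′∤)) (*-comm (p ^ s) p))
    where
    instance
      _ : NonZero p
      _ = prime⇒nonZero pp
    D≡p*D′ : D ≡ p * D′
    D≡p*D′ = trans D≡D′*p (*-comm D′ p)
    D′∣ : D′ ∣ p ^ s
    D′∣ = *-cancelˡ-∣ p (subst (_∣ p * p ^ s) D≡p*D′ D∣)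
    D′∤ : ∀ {t} → s ≡ suc t → ¬ D′ ∣ p ^ t
    D′∤ {t} refl D′∣p^t = D∤ (subst (_∣ p * p ^ t) (sym D≡p*D′) (*-monoʳ-∣ p D′∣p^t))
    D′≡ : ∀ s → D′ ∣ p ^ s → (∀ {t} → s ≡ suc t → ¬ D′ ∣ p ^ t) → D′ ≡ p ^ s
    D′≡ zero D′∣1 _ = ∣1⇒≡1 D′∣1
    D′≡ (suc t) D′∣′ D′∤′ = divisorOfPrimePower pp t D′ D′∣′ (D′∤′ refl)

  -- For any K and n ≠ 0 there is t coprime to K that is divisible by every
  -- prime divisor of n not dividing K (divide gcd(n, K) out of n repeatedly).
  coprimePart : ∀ K n → n ≢ 0 → ∃ λ t → Coprime t K × (∀ p → Prime p → p ∣ n → ¬ p ∣ K → p ∣ t)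
  coprimePart K = <-rec Part step
    where
    Part : ℕ → Set
    Part n = n ≢ 0 → ∃ λ t → Coprime t K × (∀ p → Prime p → p ∣ n → ¬ p ∣ K → p ∣ t)
    step : ∀ n → (∀ {k} → k < n → Part k) → Part n
    step n rec n≢0 with gcd n K ≟ 1
    ... | yes g≡1 = n , gcd≡1⇒coprime g≡1 , λ _ _ p∣n _ → p∣n
    ... | no g≢1 with gcd[m,n]∣m n K
    ... | divides zero n≡0 = ⊥-elim (n≢0 n≡0)
    ... | divides n′@(suc _) n≡n′*g with rec n′<n (λ ())
      where
      g>1 : 1 < gcd n K
      g>1 with gcd n K in eq
      ... | zero = ⊥-elim (n≢0 (gcd[m,n]≡0⇒m≡0 eq))
      ... | suc zero = ⊥-elim (g≢1 refl)
      ... | suc (suc _) = s≤s (s≤s z≤n)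
      n′<n : n′ < n
      n′<n = subst (n′ <_) (sym n≡n′*g) (m<m*n n′ (gcd n K) g>1)
    ... | t , t⊥K , divT = t , t⊥K , λ p pp p∣n p∤K → divT p pp (p∣n′ pp p∣n p∤K) p∤K
      where
      p∣n′ : ∀ {p} → Prime p → p ∣ n → ¬ p ∣ K → p ∣ n′
      p∣n′ {p} pp p∣n p∤K with euclidsLemma n′ (gcd n K) pp (subst (p ∣_) n≡n′*g p∣n)
      ... | inj₁ p∣n′ = p∣n′
      ... | inj₂ p∣g = ⊥-elim (p∤K (∣-trans p∣g (gcd[m,n]∣n n K)))

  -- If k is a unit modulo d, then some k + d * t is coprime to a given n ≠ 0:
  -- take t coprime to d * k but divisible by all other primes of n.
  coprimeShift : ∀ {n k d} → n ≢ 0 → Coprime k d → ∃ λ t → Coprime (k + d * t) n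
  coprimeShift {n} {k} {d} n≢0 k⊥d with coprimePart (d * k) n n≢0
  ... | t , t⊥dk , divT = t , coprimeByPrimes n≢0 noCommon
    where
    p∣k⇒p∣dt : ∀ {p} → p ∣ k + d * t → p ∣ k → p ∣ d * t
    p∣k⇒p∣dt p∣w p∣k = ∣m+n∣m⇒∣n p∣w p∣k
    p∣dt⇒p∣k : ∀ {p} → p ∣ k + d * t → p ∣ d * t → p ∣ k
    p∣dt⇒p∣k {p} p∣w p∣dt = ∣m+n∣m⇒∣n (subst (p ∣_) (+-comm k (d * t)) p∣w) p∣dt
    noCommon : ∀ p → Prime p → p ∣ k + d * t → ¬ p ∣ n
    noCommon p pp p∣w p∣n with p ∣? (d * k)
    ... | no p∤dk = p∤dk (∣n⇒∣m*n d (p∣dt⇒p∣k p∣w (∣n⇒∣m*n d (divT p pp p∣n p∤dk))))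
    ... | yes p∣dk with euclidsLemma d k pp p∣dk
    ...   | inj₁ p∣d = prime≢1 pp (k⊥d (p∣dt⇒p∣k p∣w (∣m⇒∣m*n t p∣d) , p∣d))
    ...   | inj₂ p∣k with euclidsLemma d t pp (p∣k⇒p∣dt p∣w p∣k)
    ...     | inj₁ p∣d = prime≢1 pp (k⊥d (p∣k , p∣d))
    ...     | inj₂ p∣t = prime≢1 pp (t⊥dk (p∣t , p∣dk))

  modularInverse : ∀ {w n} → 1 ≤ w → 1 ≤ n → Coprime w n → ∃₂ λ α β → α * w ≡ 1 + β * n
  modularInverse _ _ w⊥n with coprime-Bézout w⊥n
  ... | Bézout.+- x y eq = x , y , sym eq
  modularInverse {suc w₁} {suc n₁} _ _ w⊥n | Bézout.-+ x y eq =
    n₁ * x + n * w , n₁ * y + w₁ * w + w₁ , +-cancelʳ-≡ n₁ _ _ shifted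
    where
    -- From 1 + x * w ≡ y * n: multiply by n - 1 = n₁ and add n * w².
    n w : ℕ
    n = suc n₁
    w = suc w₁
    open ≡-Reasoning
    shifted : (n₁ * x + n * w) * w + n₁ ≡ (1 + (n₁ * y + w₁ * w + w₁) * n) + n₁
    shifted = begin
      (n₁ * x + n * w) * w + n₁      ≡⟨ expand n₁ x w n ⟩
      n₁ * (1 + x * w) + n * w * w   ≡⟨ cong (λ z → n₁ * z + n * w * w) eq ⟩
      n₁ * (y * n) + n * w * w       ≡⟨ collect n₁ y w₁ ⟩
      (1 + (n₁ * y + w₁ * w + w₁) * n) + n₁ ∎
      where
      expand : ∀ n₁ x w n → (n₁ * x + n * w) * w + n₁ ≡ n₁ * (1 + x * w) + n * w * w
      expand = solve-∀
      collect : ∀ n₁ y w₁ → n₁ * (y * suc n₁) + suc n₁ * suc w₁ * suc w₁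
                          ≡ (1 + (n₁ * y + w₁ * suc w₁ + w₁) * suc n₁) + n₁
      collect = solve-∀

  opaque
    unitLift : ∀ {n k d} → n ≢ 0 → d ∣ n → Coprime k d →
               ∃ λ w → (∃ λ u → w ≡ k + d * u) × (∃₂ λ α β → α * w ≡ 1 + β * n)
    unitLift {n} {k} {d} n≢0 d∣n k⊥d with coprimeShift n≢0 k⊥d
    ... | t , w₀⊥n = w , (t + n , refl) , modularInverse w≥1 (n≢0⇒n>0 n≢0) w⊥n
      where
      -- w = (k + d * t) + d * n is congruent to k + d * t modulo n but positive.
      w : ℕ
      w = k + d * (t + n)
      w≡ : w ≡ (k + d * t) + d * n
      w≡ = regroup k d t n
        where
        regroup : ∀ k d t n → k + d * (t + n) ≡ (k + d * t) + d * n
        regroup = solve-∀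
      w⊥n : Coprime w n
      w⊥n {e} (e∣w , e∣n) = w₀⊥n (∣m+n∣m⇒∣n (subst (e ∣_) (trans w≡ (+-comm _ (d * n))) e∣w) (∣n⇒∣m*n d e∣n) , e∣n)
      d≢0 : d ≢ 0
      d≢0 refl = n≢0 (0∣⇒≡0 d∣n)
      w≥1 : 1 ≤ w
      w≥1 = ≤-trans (*-mono-≤ (n≢0⇒n>0 d≢0) (≤-trans (n≢0⇒n>0 n≢0) (m≤n+m n t))) (m≤n+m (d * (t + n)) k)

  coprime⇒*-∣ : ∀ {m k t} → Coprime m k → m ∣ t → k ∣ t → m * k ∣ t
  coprime⇒*-∣ {m} {k} m⊥k m∣t (divides s refl) with coprime-divisor m⊥k (subst (m ∣_) (*-comm s k) m∣t)
  ... | divides r refl = divides r (*-assoc r m k)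

  argmax : ∀ {L} (f : Fin (suc L) → ℕ) → ∃ λ i → ∀ j → f j ≤ f i
  argmax {zero} f = Fin.zero , λ { Fin.zero → ≤-refl }
  argmax {suc L} f with argmax (f ∘ Fin.suc)
  ... | i , maxTail with f Fin.zero ≤? f (Fin.suc i)
  ...   | yes head≤ = Fin.suc i , λ { Fin.zero → head≤ ; (Fin.suc j) → maxTail j }
  ...   | no  head≰ = Fin.zero , λ { Fin.zero → ≤-refl ; (Fin.suc j) → ≤-trans (maxTail j) (<⇒≤ (≰⇒> head≰)) }

open Arithmetic

-- Multiplicative orders and roots of unity in an arbitrary field.
module FieldTheory {c ℓ} (F : CommutativeRing c ℓ) (isField : IsField F) where
  open CommutativeRing F
  open IsField isField
  open import Algebra.Properties.CommutativeSemiring.Exp commutativeSemiring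
    using (_^_; ^-congˡ; ^-homo-*; ^-assocʳ; ^-distrib-*)
  open import Algebra.Properties.Group +-group using (x∙y⁻¹≈ε⇒x≈y; //-rightDividesˡ)
  import Algebra.Properties.CommutativeSemigroup *-commutativeSemigroup as *-Props
  import Algebra.Properties.CommutativeSemigroup +-commutativeSemigroup as +-Props
  open import Relation.Binary.Reasoning.Setoid setoid

  Nonzero : Carrier → Set ℓ
  Nonzero x = ¬ x ≈ 0#

  1≉0 : Nonzero 1#
  1≉0 1≈0 = 0≉1 (sym 1≈0)

  noZeroDivisors : ∀ {x y} → Nonzero x → x * y ≈ 0# → y ≈ 0#
  noZeroDivisors {x} {y} x≉0 xy≈0 with inverse x x≉0
  ... | x⁻¹ , xx⁻¹≈1 = begin
    y               ≈⟨ *-identityˡ y ⟨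
    1# * y          ≈⟨ *-congʳ xx⁻¹≈1 ⟨
    (x * x⁻¹) * y   ≈⟨ *-Props.xy∙z≈y∙xz x x⁻¹ y ⟩
    x⁻¹ * (x * y)   ≈⟨ *-congˡ xy≈0 ⟩
    x⁻¹ * 0#        ≈⟨ zeroʳ x⁻¹ ⟩
    0#              ∎

  *-nonzero : ∀ {x y} → Nonzero x → Nonzero y → Nonzero (x * y)
  *-nonzero x≉0 y≉0 xy≈0 = y≉0 (noZeroDivisors x≉0 xy≈0)

  *-cancelˡ-nonzero : ∀ {x y z} → Nonzero x → x * y ≈ x * z → y ≈ z
  *-cancelˡ-nonzero {x} {y} {z} x≉0 xy≈xz = x∙y⁻¹≈ε⇒x≈y y z (noZeroDivisors x≉0 (begin
    x * (y - z)        ≈⟨ distribˡ x y (- z) ⟩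
    x * y + x * - z    ≈⟨ +-congʳ xy≈xz ⟩
    x * z + x * - z    ≈⟨ distribˡ x z (- z) ⟨
    x * (z - z)        ≈⟨ *-congˡ (-‿inverseʳ z) ⟩
    x * 0#             ≈⟨ zeroʳ x ⟩
    0#                 ∎))

  ^-nonzero : ∀ {x} k → Nonzero x → Nonzero (x ^ k)
  ^-nonzero zero    _   = 1≉0
  ^-nonzero (suc k) x≉0 = *-nonzero x≉0 (^-nonzero k x≉0)

  1^k≈1 : ∀ k → 1# ^ k ≈ 1#
  1^k≈1 zero    = refl
  1^k≈1 (suc k) = trans (*-identityˡ _) (1^k≈1 k)

  ^-multiple : ∀ {x} m t → x ^ m ≈ 1# → x ^ (m ℕ.* t) ≈ 1#
  ^-multiple {x} m t xᵐ≈1 = begin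
    x ^ (m ℕ.* t)   ≈⟨ ^-assocʳ x m t ⟨
    (x ^ m) ^ t     ≈⟨ ^-congˡ t xᵐ≈1 ⟩
    1# ^ t          ≈⟨ 1^k≈1 t ⟩
    1#              ∎

  ^-swap : ∀ x i j → (x ^ i) ^ j ≈ (x ^ j) ^ i
  ^-swap x i j = begin
    (x ^ i) ^ j      ≈⟨ ^-assocʳ x i j ⟩
    x ^ (i ℕ.* j)    ≡⟨ ≡.cong (x ^_) (ℕ.*-comm i j) ⟩
    x ^ (j ℕ.* i)    ≈⟨ ^-assocʳ x j i ⟨
    (x ^ j) ^ i      ∎

  ^-cancel : ∀ {a} i k → Nonzero a → a ^ (i ℕ.+ k) ≈ a ^ i → a ^ k ≈ 1#
  ^-cancel {a} i k a≉0 eq = *-cancelˡ-nonzero (^-nonzero i a≉0) (begin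
    a ^ i * a ^ k    ≈⟨ ^-homo-* a i k ⟨
    a ^ (i ℕ.+ k)    ≈⟨ eq ⟩
    a ^ i            ≈⟨ *-identityʳ (a ^ i) ⟨
    a ^ i * 1#       ∎)

  record IsOrder (a : Carrier) (m : ℕ) : Set ℓ where
    field
      positive : 1 ℕ.≤ m
      root     : a ^ m ≈ 1#
      minimal  : ∀ k → a ^ k ≈ 1# → m ∣ k
  open IsOrder

  order⇒nonzero : ∀ {a m} → IsOrder a m → Nonzero a
  order⇒nonzero {a} {suc m} o a≈0 = 0≉1 (begin
    0#             ≈⟨ zeroˡ (a ^ m) ⟨
    0# * a ^ m     ≈⟨ *-congʳ a≈0 ⟨
    a ^ suc m      ≈⟨ root o ⟩
    1#             ∎)

  order-1 : IsOrder 1# 1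
  order-1 = record { positive = s≤s z≤n ; root = *-identityʳ 1# ; minimal = λ k _ → 1∣ k }

  order-unique : ∀ {a m m′} → IsOrder a m → IsOrder a m′ → m ≡ m′
  order-unique o o′ = ∣-antisym (minimal o _ (root o′)) (minimal o′ _ (root o))

  order-cong : ∀ {a b m} → a ≈ b → IsOrder a m → IsOrder b m
  order-cong {m = m} a≈b o = record
    { positive = positive o
    ; root     = trans (^-congˡ m (sym a≈b)) (root o)
    ; minimal  = λ k bᵏ≈1 → minimal o k (trans (^-congˡ k a≈b) bᵏ≈1)
    }

  ^-order-multiple : ∀ {a m k} → IsOrder a m → m ∣ k → a ^ k ≈ 1#
  ^-order-multiple {a} {m} o (divides t ≡.refl) =
    ≡.subst (λ e → a ^ e ≈ 1#) (ℕ.*-comm m t) (^-multiple m t (root o))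

  order-^ : ∀ {a} j t → IsOrder a (j ℕ.* t) → IsOrder (a ^ j) t
  order-^ zero    t o = ⊥-elim (ℕ.<-irrefl ≡.refl (positive o))
  order-^ (suc j) zero o = ⊥-elim (ℕ.<-irrefl (≡.sym (ℕ.*-zeroʳ j)) (positive o))
  order-^ {a} (suc j) (suc t) o = record
    { positive = s≤s z≤n
    ; root     = trans (^-assocʳ a (suc j) (suc t)) (root o)
    ; minimal  = λ k aʲᵏ≈1 → *-cancelˡ-∣ (suc j) (minimal o _ (trans (sym (^-assocʳ a (suc j) k)) aʲᵏ≈1))
    }

  ^-factor : ∀ {x y} s → (x * y) ^ s ≈ 1# → y ^ s ≈ 1# → x ^ s ≈ 1#
  ^-factor {x} {y} s xyˢ≈1 yˢ≈1 = begin
    x ^ s            ≈⟨ *-identityʳ (x ^ s) ⟨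
    x ^ s * 1#       ≈⟨ *-congˡ yˢ≈1 ⟨
    x ^ s * y ^ s    ≈⟨ ^-distrib-* x y s ⟨
    (x * y) ^ s      ≈⟨ xyˢ≈1 ⟩
    1#               ∎

  order-* : ∀ {a b m k} → IsOrder a m → IsOrder b k → Coprime m k → IsOrder (a * b) (m ℕ.* k)
  order-* {a} {b} {m} {k} oa ob m⊥k = record
    { positive = ℕ.*-mono-≤ (positive oa) (positive ob)
    ; root     = begin
        (a * b) ^ (m ℕ.* k)             ≈⟨ ^-distrib-* a b (m ℕ.* k) ⟩
        a ^ (m ℕ.* k) * b ^ (m ℕ.* k)   ≈⟨ *-cong (^-order-multiple oa (m∣m*n k)) (^-order-multiple ob (n∣m*n m)) ⟩
        1# * 1#                         ≈⟨ *-identityˡ 1# ⟩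
        1#                              ∎
    ; minimal  = λ t abᵗ≈1 → coprime⇒*-∣ m⊥k (m∣t t abᵗ≈1) (k∣t t abᵗ≈1)
    }
    where
    m∣t : ∀ t → (a * b) ^ t ≈ 1# → m ∣ t
    m∣t t abᵗ≈1 = coprime-divisor m⊥k (≡.subst (m ∣_) (ℕ.*-comm t k) (minimal oa _
      (^-factor (t ℕ.* k) (^-multiple t k abᵗ≈1) (^-order-multiple ob (n∣m*n t)))))
    k∣t : ∀ t → (a * b) ^ t ≈ 1# → k ∣ t
    k∣t t abᵗ≈1 = coprime-divisor (Coprimality.sym m⊥k) (≡.subst (k ∣_) (ℕ.*-comm t m) (minimal ob _
      (^-factor (t ℕ.* m) (^-multiple t m (trans (^-congˡ t (*-comm b a)) abᵗ≈1)) (^-order-multiple oa (n∣m*n t)))))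

  powers-distinct-≤ : ∀ {a m i j} → IsOrder a m → i ℕ.≤ j → j ℕ.< m → a ^ i ≈ a ^ j → i ≡ j
  powers-distinct-≤ {a} {m} {i} {j} o i≤j j<m aⁱ≈aʲ with j ℕ.∸ i | ℕ.m+[n∸m]≡n i≤j | ℕ.m∸n≤m j i
  ... | zero  | i+0≡j | _   = ≡.trans (≡.sym (ℕ.+-identityʳ i)) i+0≡j
  ... | suc t | i+t≡j | t≤j = ⊥-elim (ℕ.<-irrefl ≡.refl (ℕ.≤-<-trans (ℕ.≤-trans m≤t t≤j) j<m))
    where
    m≤t : m ℕ.≤ suc t
    m≤t = ∣⇒≤ (minimal o (suc t) (^-cancel i (suc t) (order⇒nonzero o)
            (trans (≡.subst (λ e → a ^ e ≈ a ^ j) (≡.sym i+t≡j) refl) (sym aⁱ≈aʲ))))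

  powers-distinct : ∀ {a m i j} → IsOrder a m → i ℕ.< m → j ℕ.< m → a ^ i ≈ a ^ j → i ≡ j
  powers-distinct {i = i} {j} o i<m j<m aⁱ≈aʲ with ℕ.≤-total i j
  ... | inj₁ i≤j = powers-distinct-≤ o i≤j j<m aⁱ≈aʲ
  ... | inj₂ j≤i = ≡.sym (powers-distinct-≤ o j≤i i<m (sym aⁱ≈aʲ))

  -- A monic polynomial of degree d is given by its lower coefficients c₀ … c_{d-1}
  -- and evaluated in Horner form.
  monic : List Carrier → Carrier → Carrier
  monic []       x = 1#
  monic (c ∷ cs) x = c + x * monic cs x

  -- Synthetic division by x - r: the quotient is monic of degree one less.
  quotient : Carrier → List Carrier → List Carrier
  quotient r []                 = []
  quotient r (c ∷ [])           = []
  quotient r (c ∷ cs@(_ ∷ _))   = monic cs r ∷ quotient r cs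

  quotient-length : ∀ r c cs → length (quotient r (c ∷ cs)) ≡ length cs
  quotient-length r c []        = ≡.refl
  quotient-length r c (c′ ∷ cs) = ≡.cong suc (quotient-length r c′ cs)

  division : ∀ r c cs x → monic (c ∷ cs) x ≈ (x - r) * monic (quotient r (c ∷ cs)) x + monic (c ∷ cs) r
  division r c [] x = begin
    c + x * 1#                       ≈⟨ +-congˡ (*-identityʳ x) ⟩
    c + x                            ≈⟨ +-congˡ (//-rightDividesˡ r x) ⟨
    c + ((x - r) + r)                ≈⟨ +-Props.x∙yz≈y∙xz c (x - r) r ⟩
    (x - r) + (c + r)                ≈⟨ +-cong (*-identityʳ (x - r)) (+-congˡ (*-identityʳ r)) ⟨
    (x - r) * 1# + (c + r * 1#)      ∎
  division r c (c′ ∷ cs) x = sym (begin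
    y * (Mr + x * Q) + (c + r * Mr)        ≈⟨ +-congʳ (distribˡ y Mr (x * Q)) ⟩
    (y * Mr + y * (x * Q)) + (c + r * Mr)  ≈⟨ +-Props.x∙yz≈y∙xz _ c (r * Mr) ⟩
    c + ((y * Mr + y * (x * Q)) + r * Mr)  ≈⟨ +-congˡ (+-Props.xy∙z≈xz∙y (y * Mr) _ (r * Mr)) ⟩
    c + ((y * Mr + r * Mr) + y * (x * Q))  ≈⟨ +-congˡ (+-cong (distribʳ Mr y r) (*-Props.x∙yz≈y∙xz x y Q)) ⟨
    c + ((y + r) * Mr + x * (y * Q))       ≈⟨ +-congˡ (+-congʳ (*-congʳ (//-rightDividesˡ r x))) ⟩
    c + (x * Mr + x * (y * Q))             ≈⟨ +-congˡ (distribˡ x Mr (y * Q)) ⟨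
    c + x * (Mr + y * Q)                   ≈⟨ +-congˡ (*-congˡ (+-comm Mr (y * Q))) ⟩
    c + x * (y * Q + Mr)                   ≈⟨ +-congˡ (*-congˡ (division r c′ cs x)) ⟨
    c + x * monic (c′ ∷ cs) x              ∎)
    where
    y  = x - r
    Mr = monic (c′ ∷ cs) r
    Q  = monic (quotient r (c′ ∷ cs)) x

  rootBound : ∀ (P : List Carrier) L (f : Fin L → Carrier) → (∀ i j → f i ≈ f j → i ≡ j) →
              (∀ i → monic P (f i) ≈ 0#) → L ℕ.≤ length P
  rootBound P        zero    f f-inj roots = z≤n
  rootBound []       (suc L) f f-inj roots = ⊥-elim (1≉0 (roots Fin.zero))
  rootBound (c ∷ cs) (suc L) f f-inj roots = s≤s (≡.subst (L ℕ.≤_) (quotient-length r c cs)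
      (rootBound (quotient r (c ∷ cs)) L (f ∘ Fin.suc) (λ i j eq → Fin.suc-injective (f-inj _ _ eq)) otherRoots))
    where
    r = f Fin.zero
    -- Every other root x ≠ r is a root of the quotient, since (x - r) Q(x) ≈ P(x) - P(r) ≈ 0.
    otherRoots : ∀ i → monic (quotient r (c ∷ cs)) (f (Fin.suc i)) ≈ 0#
    otherRoots i = noZeroDivisors x-r≉0 (begin
      (x - r) * monic (quotient r (c ∷ cs)) x        ≈⟨ +-identityʳ _ ⟨
      (x - r) * monic (quotient r (c ∷ cs)) x + 0#   ≈⟨ +-congˡ (roots Fin.zero) ⟨
      (x - r) * monic (quotient r (c ∷ cs)) x + monic (c ∷ cs) r ≈⟨ division r c cs x ⟨
      monic (c ∷ cs) x                               ≈⟨ roots (Fin.suc i) ⟩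
      0#                                             ∎)
      where
      x = f (Fin.suc i)
      x-r≉0 : Nonzero (x - r)
      x-r≉0 x-r≈0 with f-inj _ _ (x∙y⁻¹≈ε⇒x≈y x r x-r≈0)
      ... | ()

  monic-xᵏ : ∀ k x → monic (replicate k 0#) x ≈ x ^ k
  monic-xᵏ zero    x = refl
  monic-xᵏ (suc k) x = trans (+-identityˡ _) (*-congˡ (monic-xᵏ k x))

  rootsOfUnityBound : ∀ d L (f : Fin L → Carrier) → (∀ i j → f i ≈ f j → i ≡ j) →
                      (∀ i → f i ^ suc d ≈ 1#) → L ℕ.≤ suc d
  rootsOfUnityBound d L f f-inj roots = ≡.subst (L ℕ.≤_) (≡.cong suc (length-replicate d))
    (rootBound (- 1# ∷ replicate d 0#) L f f-inj isRoot)
    where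
    isRoot : ∀ i → monic (- 1# ∷ replicate d 0#) (f i) ≈ 0#
    isRoot i = begin
      - 1# + f i * monic (replicate d 0#) (f i)   ≈⟨ +-congˡ (*-congˡ (monic-xᵏ d (f i))) ⟩
      - 1# + f i ^ suc d                          ≈⟨ +-congˡ (roots i) ⟩
      - 1# + 1#                                   ≈⟨ -‿inverseˡ 1# ⟩
      0#                                          ∎

  -- If x ^ m has order r * p (p prime) and m = p ^ s * m₀, then x ^ (m₀ * r)
  -- has order exactly p ^ (s + 1): its order divides p ^ (s + 1) but not p ^ s.
  primePowerOrder : ∀ {x m p r s m₀ D} → Prime p → IsOrder (x ^ m) (r ℕ.* p) → m ≡ p ℕ.^ s ℕ.* m₀ →
                    IsOrder (x ^ (m₀ ℕ.* r)) D → D ≡ p ℕ.^ suc s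
  primePowerOrder {x} {m} {p} {r} {s} {m₀} {D} pp oxᵐ m≡ oz =
    divisorOfPrimePower pp s D (minimal oz _ zᵖˢ⁺¹≈1) (λ D∣pˢ → zᵖˢ≉1 (^-order-multiple oz D∣pˢ))
    where
    z = x ^ (m₀ ℕ.* r)
    z^ : ∀ e t → m₀ ℕ.* r ℕ.* e ≡ m ℕ.* t → z ^ e ≈ (x ^ m) ^ t
    z^ e t eq = begin
      z ^ e                     ≈⟨ ^-assocʳ x (m₀ ℕ.* r) e ⟩
      x ^ (m₀ ℕ.* r ℕ.* e)      ≡⟨ ≡.cong (x ^_) eq ⟩
      x ^ (m ℕ.* t)             ≈⟨ ^-assocʳ x m t ⟨
      (x ^ m) ^ t               ∎
    zᵖˢ⁺¹≈1 : z ^ (p ℕ.^ suc s) ≈ 1#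
    zᵖˢ⁺¹≈1 = trans (z^ _ (r ℕ.* p) (≡.trans (regroup₁ m₀ r p (p ℕ.^ s)) (≡.cong (ℕ._* (r ℕ.* p)) (≡.sym m≡)))) (root oxᵐ)
      where
      regroup₁ : ∀ m₀ r p P → m₀ ℕ.* r ℕ.* (p ℕ.* P) ≡ P ℕ.* m₀ ℕ.* (r ℕ.* p)
      regroup₁ = solve-∀
    -- z ^ (p ^ s) ≈ (x ^ m) ^ r ≉ 1 because 0 < r < r * p.
    zᵖˢ≉1 : ¬ z ^ (p ℕ.^ s) ≈ 1#
    zᵖˢ≉1 zᵖˢ≈1 = ℕ.<-irrefl ≡.refl (ℕ.≤-<-trans (∣⇒≤ {{r≢0}} rp∣r) (ℕ.m<m*n r p {{r≢0}} (prime>1 pp)))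
      where
      regroup₂ : ∀ m₀ r P → m₀ ℕ.* r ℕ.* P ≡ P ℕ.* m₀ ℕ.* r
      regroup₂ = solve-∀
      rp∣r : r ℕ.* p ∣ r
      rp∣r = minimal oxᵐ r (trans (sym (z^ _ r (≡.trans (regroup₂ m₀ r (p ℕ.^ s)) (≡.cong (ℕ._* r) (≡.sym m≡))))) zᵖˢ≈1)
      r≢0 : ℕ.NonZero r
      r≢0 = ℕ.≢-nonZero λ { ≡.refl → ℕ.<-irrefl ≡.refl (positive oxᵐ) }

  module WithDecidableEquality (_≟_ : Decidable _≈_) where

    orderFromRoot : ∀ {a} d → a ^ suc d ≈ 1# → ∃ (IsOrder a)
    orderFromRoot {a} d aᵈ⁺¹≈1 with leastWitness (λ k → (a ^ suc k) ≟ 1#) {d} aᵈ⁺¹≈1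
    ... | m₀ , aᵐ≈1 , below = m , record { positive = s≤s z≤n ; root = aᵐ≈1 ; minimal = m∣ }
      where
      m = suc m₀
      -- Divide k by m: a nonzero remainder r would give a ^ r ≈ 1 with 0 < r < m.
      m∣ : ∀ k → a ^ k ≈ 1# → m ∣ k
      m∣ k aᵏ≈1 with k % m | m%n<n k m | m≡m%n+[m/n]*n k m
      ... | zero  | _   | k≡ = divides (k / m) k≡
      ... | suc r | r<m | k≡ = ⊥-elim (below (ℕ.≤-pred r<m) (begin
        a ^ suc r                         ≈⟨ *-identityʳ _ ⟨
        a ^ suc r * 1#                    ≈⟨ *-congˡ aᴷᵐ≈1 ⟨
        a ^ suc r * a ^ (k / m ℕ.* m)     ≈⟨ ^-homo-* a (suc r) (k / m ℕ.* m) ⟨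
        a ^ (suc r ℕ.+ k / m ℕ.* m)       ≡⟨ ≡.cong (a ^_) k≡ ⟨
        a ^ k                             ≈⟨ aᵏ≈1 ⟩
        1#                                ∎))
        where
        aᴷᵐ≈1 : a ^ (k / m ℕ.* m) ≈ 1#
        aᴷᵐ≈1 = ≡.subst (λ e → a ^ e ≈ 1#) (ℕ.*-comm m (k / m)) (^-multiple m (k / m) aᵐ≈1)

    -- If a has order d, every solution of x ^ d ≈ 1 is a power of a:
    -- otherwise there would be d + 1 distinct solutions.
    rootOfUnity⇒power : ∀ {a b d} → IsOrder a d → b ^ d ≈ 1# → ∃ λ k → a ^ k ≈ b
    rootOfUnity⇒power {d = zero} oa _ = ⊥-elim (ℕ.<-irrefl ≡.refl (positive oa))
    rootOfUnity⇒power {a} {b} {suc d} oa bᵈ≈1 with Fin.any? (λ (i : Fin (suc d)) → (a ^ toℕ i) ≟ b)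
    ... | yes (i , aⁱ≈b) = toℕ i , aⁱ≈b
    ... | no notPower = ⊥-elim (ℕ.<-irrefl ≡.refl (rootsOfUnityBound d (suc (suc d)) roots roots-inj isRoot))
      where
      roots : Fin (suc (suc d)) → Carrier
      roots Fin.zero    = b
      roots (Fin.suc i) = a ^ toℕ i
      roots-inj : ∀ i j → roots i ≈ roots j → i ≡ j
      roots-inj Fin.zero    Fin.zero    _ = ≡.refl
      roots-inj Fin.zero    (Fin.suc j) b≈aʲ = ⊥-elim (notPower (j , sym b≈aʲ))
      roots-inj (Fin.suc i) Fin.zero    aⁱ≈b = ⊥-elim (notPower (i , aⁱ≈b))
      roots-inj (Fin.suc i) (Fin.suc j) aⁱ≈aʲ =
        ≡.cong Fin.suc (Fin.toℕ-injective (powers-distinct oa (Fin.toℕ<n i) (Fin.toℕ<n j) aⁱ≈aʲ))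
      isRoot : ∀ i → roots i ^ suc d ≈ 1#
      isRoot Fin.zero    = bᵈ≈1
      isRoot (Fin.suc i) = trans (^-swap a (toℕ i) (suc d)) (trans (^-congˡ (toℕ i) (root oa)) (1^k≈1 (toℕ i)))

    sameOrder⇒power : ∀ {a b d} → IsOrder a d → IsOrder b d → ∃ λ k → a ^ k ≈ b × Coprime k d
    sameOrder⇒power {a} {b} {d} oa ob with rootOfUnity⇒power oa (root ob)
    ... | k , aᵏ≈b = k , aᵏ≈b , k⊥d
      where
      -- A common divisor e with d = d₁ * e forces b ^ d₁ ≈ 1, hence d ∣ d₁ and e = 1.
      k⊥d : Coprime k d
      k⊥d {e} (divides k₁ k≡ , divides d₁ d≡) = ℕ.*-cancelˡ-≡ e 1 d₁ {{d₁≢0}} (≡.sym (≡.trans d₁*1≡d d≡))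
        where
        k*d₁≡k₁*d : k ℕ.* d₁ ≡ k₁ ℕ.* d
        k*d₁≡k₁*d = ≡.trans (≡.cong (ℕ._* d₁) k≡) (≡.trans (ℕ.*-assoc k₁ e d₁)
                      (≡.cong (k₁ ℕ.*_) (≡.trans (ℕ.*-comm e d₁) (≡.sym d≡))))
        bᵈ¹≈1 : b ^ d₁ ≈ 1#
        bᵈ¹≈1 = begin
          b ^ d₁               ≈⟨ ^-congˡ d₁ aᵏ≈b ⟨
          (a ^ k) ^ d₁         ≈⟨ ^-assocʳ a k d₁ ⟩
          a ^ (k ℕ.* d₁)       ≡⟨ ≡.cong (a ^_) k*d₁≡k₁*d ⟩
          a ^ (k₁ ℕ.* d)       ≈⟨ ^-order-multiple oa (n∣m*n k₁) ⟩
          1#                   ∎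
        d₁≢0 : ℕ.NonZero d₁
        d₁≢0 = ℕ.≢-nonZero λ d₁≡0 →
          ℕ.<⇒≢ (positive ob) (≡.sym (≡.trans d≡ (≡.cong (ℕ._* e) d₁≡0)))
        d₁*1≡d : d₁ ℕ.* 1 ≡ d
        d₁*1≡d = ≡.trans (ℕ.*-identityʳ d₁) (∣-antisym (divides e (≡.trans d≡ (ℕ.*-comm d₁ e))) (minimal ob d₁ bᵈ¹≈1))

  module FiniteField (n : ℕ) (ι : HasOrder F (suc n)) where
    open Inverse ι using () renaming
      (to to index; from to element; to-cong to index-cong;
       strictlyInverseˡ to index∘element; strictlyInverseʳ to element∘index)

    index-injective : ∀ {x y} → index x ≡ index y → x ≈ y
    index-injective {x} {y} eq = begin
      x                  ≈⟨ element∘index x ⟨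
      element (index x)  ≡⟨ ≡.cong element eq ⟩
      element (index y)  ≈⟨ element∘index y ⟩
      y                  ∎

    _≟_ : Decidable _≈_
    x ≟ y = map′ index-injective index-cong (index x Fin.≟ index y)

    open WithDecidableEquality _≟_ public

    -- By pigeonhole two of a ^ 0, …, a ^ (n + 1) coincide, so some a ^ d ≈ 1 with d > 0.
    opaque
      orderExists : ∀ {a} → Nonzero a → ∃ (IsOrder a)
      orderExists {a} a≉0 with Fin.pigeonhole (ℕ.n<1+n (suc n)) (λ i → index (a ^ toℕ i))
      ... | i , j , i<j , same = orderFromRoot (ℕ.pred d) (≡.subst (λ e → a ^ e ≈ 1#) d≡ aᵈ≈1)
        where
        d : ℕ
        d = toℕ j ℕ.∸ toℕ i
        d≡ : d ≡ suc (ℕ.pred d)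
        d≡ = ≡.sym (ℕ.suc-pred d {{ℕ.>-nonZero (ℕ.m<n⇒0<n∸m i<j)}})
        aᵈ≈1 : a ^ d ≈ 1#
        aᵈ≈1 = ^-cancel (toℕ i) d a≉0
          (≡.subst (λ e → a ^ e ≈ a ^ toℕ i) (≡.sym (ℕ.m+[n∸m]≡n (ℕ.<⇒≤ i<j))) (sym (index-injective same)))

    nonzeroElement : Fin n → Carrier
    nonzeroElement i = element (punchIn (index 0#) i)

    nonzeroElement-nonzero : ∀ i → Nonzero (nonzeroElement i)
    nonzeroElement-nonzero i x≈0 = Fin.punchInᵢ≢i (index 0#) i (≡.trans (≡.sym (index∘element _)) (index-cong x≈0))

    nonzeroElement-injective : ∀ i j → nonzeroElement i ≈ nonzeroElement j → i ≡ j
    nonzeroElement-injective i j eq = Fin.punchIn-injective (index 0#) i j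
      (≡.trans (≡.sym (index∘element _)) (≡.trans (index-cong eq) (index∘element _)))

    -- The order of the element with a given index (0 for the zero element).
    orderAt : Fin (suc n) → ℕ
    orderAt i with element i ≟ 0#
    ... | yes _   = 0
    ... | no  x≉0 = proj₁ (orderExists x≉0)

    orderAt-nonzero : ∀ i → Nonzero (element i) → IsOrder (element i) (orderAt i)
    orderAt-nonzero i x≉0 with element i ≟ 0#
    ... | yes x≈0 = ⊥-elim (x≉0 x≈0)
    ... | no  x≉0′ = proj₂ (orderExists x≉0′)

    orderAt-zero : ∀ i → element i ≈ 0# → orderAt i ≡ 0
    orderAt-zero i x≈0 with element i ≟ 0#
    ... | yes _   = ≡.refl
    ... | no  x≉0 = ⊥-elim (x≉0 x≈0)

    orderAt-index : ∀ {x k} → IsOrder x k → orderAt (index x) ≡ k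
    orderAt-index {x} o = order-unique (orderAt-nonzero (index x) (order⇒nonzero o′)) o′
      where
      o′ : IsOrder (element (index x)) _
      o′ = order-cong (sym (element∘index x)) o

    maximalOrder : ∃₂ λ g m → IsOrder g m × (∀ {x k} → IsOrder x k → k ℕ.≤ m)
    maximalOrder with argmax orderAt
    ... | i , isMax = element i , orderAt i , orderAt-nonzero i g≉0 ,
                      λ {x} o → ≡.subst (ℕ._≤ orderAt i) (orderAt-index o) (isMax (index x))
      where
      g≉0 : Nonzero (element i)
      g≉0 g≈0 = ℕ.<-irrefl ≡.refl (≡.subst₂ ℕ._≤_ (orderAt-index order-1) (orderAt-zero i g≈0) (isMax (index 1#)))

    -- An element x ≠ 0 with x ^ m ≉ 1, where g has order m, yields an element of larger
    -- order: x ^ m has an order r * p with p prime; writing m = p ^ s * m₀ (p ∤ m₀),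
    -- the element x ^ (m₀ * r) * g ^ (p ^ s) has order p ^ (s + 1) * m₀ > m.
    largerOrder : ∀ {g m x} → IsOrder g m → Nonzero x → ¬ x ^ m ≈ 1# → ∃₂ λ y k → IsOrder y k × m ℕ.< k
    largerOrder {g} {m} {x} og x≉0 xᵐ≉1 = fromOrder (orderExists (^-nonzero m x≉0))
      where
      fromSplit : ∀ {p r} → Prime p → IsOrder (x ^ m) (r ℕ.* p) →
                  (∃₂ λ s m₀ → m ≡ p ℕ.^ s ℕ.* m₀ × ¬ p ∣ m₀) → ∃₂ λ y k → IsOrder y k × m ℕ.< k
      fromSplit {p} {r} pp oxᵐ (s , m₀ , m≡ , p∤m₀) =
        _ , _ , order-* oz og′ (coprimePrimePower pp p∤m₀ (suc s)) , m<pˢ⁺¹m₀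
        where
        oz : IsOrder (x ^ (m₀ ℕ.* r)) (p ℕ.^ suc s)
        oz with orderExists (^-nonzero (m₀ ℕ.* r) x≉0)
        ... | D , oD = ≡.subst (IsOrder _) (primePowerOrder {r = r} {s = s} {m₀ = m₀} pp oxᵐ m≡ oD) oD
        og′ : IsOrder (g ^ (p ℕ.^ s)) m₀
        og′ = order-^ (p ℕ.^ s) m₀ (≡.subst (IsOrder g) m≡ og)
        m<pˢ⁺¹m₀ : m ℕ.< p ℕ.^ suc s ℕ.* m₀
        m<pˢ⁺¹m₀ = ≡.subst (m ℕ.<_) (≡.trans (≡.cong (ℕ._* p) m≡) (regroup (p ℕ.^ s) m₀ p))
                     (ℕ.m<m*n m p {{ℕ.>-nonZero (positive og)}} (prime>1 pp))
          where
          regroup : ∀ P m₀ p → P ℕ.* m₀ ℕ.* p ≡ p ℕ.* P ℕ.* m₀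
          regroup = solve-∀
      fromFactor : ∀ {e} → IsOrder (x ^ m) e → (∃ λ p → Prime p × p ∣ e) → ∃₂ λ y k → IsOrder y k × m ℕ.< k
      fromFactor oxᵐ (p , pp , divides r ≡.refl) =
        fromSplit {r = r} pp oxᵐ (primePowerSplit pp m (ℕ.<⇒≢ (positive og) ∘ ≡.sym))
      fromOrder : ∃ (IsOrder (x ^ m)) → ∃₂ λ y k → IsOrder y k × m ℕ.< k
      fromOrder (zero          , o) = ⊥-elim (ℕ.<-irrefl ≡.refl (positive o))
      fromOrder (suc zero      , o) = ⊥-elim (xᵐ≉1 (trans (sym (*-identityʳ (x ^ m))) (root o)))
      fromOrder (k@(suc (suc _)) , o) = fromFactor o (primeFactor k (s≤s (s≤s z≤n)))

    maximal⇒exponent : ∀ {g m} → IsOrder g m → (∀ {x k} → IsOrder x k → k ℕ.≤ m) →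
                       ∀ {x} → Nonzero x → x ^ m ≈ 1#
    maximal⇒exponent {m = m} og isMax {x} x≉0 with (x ^ m) ≟ 1#
    ... | yes xᵐ≈1 = xᵐ≈1
    ... | no  xᵐ≉1 with largerOrder og x≉0 xᵐ≉1
    ...   | _ , _ , oy , m<k = ⊥-elim (ℕ.<-irrefl ≡.refl (ℕ.<-≤-trans m<k (isMax oy)))

    -- The multiplicative group is cyclic of order n: some g has order n, and x ^ n ≈ 1 for all x ≠ 0.
    -- With g of maximal order m, all n nonzero elements are roots of x ^ m ≈ 1, so n ≤ m;
    -- and 0, g ^ 0, …, g ^ (m - 1) are m + 1 distinct elements, so m ≤ n.
    cyclic : ∃ λ g → IsOrder g n × (∀ {x} → Nonzero x → x ^ n ≈ 1#)
    cyclic with maximalOrder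
    ... | g , m , og , isMax = g , ≡.subst (IsOrder g) m≡n og , ≡.subst (λ e → _ ^ e ≈ 1#) m≡n ∘ exponent
      where
      exponent : ∀ {x} → Nonzero x → x ^ m ≈ 1#
      exponent = maximal⇒exponent og isMax
      n≤m : ∀ k → IsOrder g k → (∀ {x} → Nonzero x → x ^ k ≈ 1#) → n ℕ.≤ k
      n≤m zero     og _   = ⊥-elim (ℕ.<-irrefl ≡.refl (positive og))
      n≤m (suc k′) _  exp = rootsOfUnityBound k′ n nonzeroElement nonzeroElement-injective
                              (λ i → exp (nonzeroElement-nonzero i))
      zeroAndPowers : Fin (suc m) → Fin (suc n)
      zeroAndPowers Fin.zero    = index 0#
      zeroAndPowers (Fin.suc i) = index (g ^ toℕ i)
      zeroAndPowers-injective : ∀ {i j} → zeroAndPowers i ≡ zeroAndPowers j → i ≡ j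
      zeroAndPowers-injective {Fin.zero}  {Fin.zero}  _  = ≡.refl
      zeroAndPowers-injective {Fin.zero}  {Fin.suc j} eq = ⊥-elim (^-nonzero (toℕ j) (order⇒nonzero og) (sym (index-injective eq)))
      zeroAndPowers-injective {Fin.suc i} {Fin.zero}  eq = ⊥-elim (^-nonzero (toℕ i) (order⇒nonzero og) (index-injective eq))
      zeroAndPowers-injective {Fin.suc i} {Fin.suc j} eq =
        ≡.cong Fin.suc (Fin.toℕ-injective (powers-distinct og (Fin.toℕ<n i) (Fin.toℕ<n j) (index-injective eq)))
      m≡n : m ≡ n
      m≡n = ℕ.≤-antisym (ℕ.≤-pred (Fin.injective⇒≤ zeroAndPowers-injective)) (n≤m m og exponent)

    fermat : ∀ {x} → Nonzero x → x ^ n ≈ 1#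
    fermat = proj₂ (proj₂ cyclic)

    n≢0 : n ≢ 0
    n≢0 n≡0 = ℕ.<⇒≢ (positive (proj₁ (proj₂ cyclic))) (≡.sym n≡0)

    order∣n : ∀ {a k} → IsOrder a k → k ∣ n
    order∣n o = minimal o _ (fermat (order⇒nonzero o))

    elementOfOrder : ∀ {d} → d ∣ n → ∃ λ a → IsOrder a d
    elementOfOrder {d} (divides e n≡e*d) with cyclic
    ... | g , og , _ = g ^ e , order-^ e d (≡.subst (IsOrder g) n≡e*d og)

lookup-injective : ∀ {a} {A : Set a} {xs : List A} → Unique xs → ∀ i j → lookup xs i ≡ lookup xs j → i ≡ j
lookup-injective (_ ∷ _)        Fin.zero    Fin.zero    _  = ≡.refl
lookup-injective (x∉xs ∷ _)     Fin.zero    (Fin.suc j) eq = ⊥-elim (All.lookup x∉xs (∈-lookup j) eq)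
lookup-injective (x∉xs ∷ _)     (Fin.suc i) Fin.zero    eq = ⊥-elim (All.lookup x∉xs (∈-lookup i) (≡.sym eq))
lookup-injective (_ ∷ unique)   (Fin.suc i) (Fin.suc j) eq = ≡.cong Fin.suc (lookup-injective unique i j eq)

hasNClasses-⊎ : ∀ {p r} {P : Set p} {_~_ : P → P → Set r} {m k} (rep : Fin m ⊎ Fin k → P) →
                (∀ s t → rep s ~ rep t → s ≡ t) → (∀ x → ∃ λ s → x ~ rep s) →
                HasNClasses P _~_ (m ℕ.+ k)
hasNClasses-⊎ {_~_ = _~_} {m} {k} rep rep-inj cover = rep ∘ splitAt m , inj , cover′
  where
  inj : ∀ i j → rep (splitAt m i) ~ rep (splitAt m j) → i ≡ j
  inj i j eq = ≡.trans (≡.sym (Fin.join-splitAt m k i))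
    (≡.trans (≡.cong (join m k) (rep-inj _ _ eq)) (Fin.join-splitAt m k j))
  cover′ : ∀ x → ∃ λ i → x ~ rep (splitAt m i)
  cover′ x with cover x
  ... | s , x~s = join m k s , ≡.subst (λ t → x ~ rep t) (≡.sym (Fin.splitAt-join m k s)) x~s

module Dynamics {a ℓa} (S : Setoid a ℓa) where
  open Setoid S

  dynEquiv-trans : ∀ {f g h} → DynEquiv S f g → DynEquiv S g h → DynEquiv S f h
  dynEquiv-trans (σ , σf≈gσ) (τ , τg≈hτ) = Compose.bijection σ τ , λ x →
    trans (Bijection.cong τ (σf≈gσ x)) (τg≈hτ (Bijection.to σ x))

  bijection : (f g : Carrier → Carrier) → (∀ {x y} → x ≈ y → f x ≈ f y) → (∀ {x y} → x ≈ y → g x ≈ g y) →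
              (∀ x → f (g x) ≈ x) → (∀ x → g (f x) ≈ x) → Bijection S S
  bijection f g f-cong g-cong fg≈id gf≈id = Inverse⇒Bijection (record
    { to = f ; from = g ; to-cong = f-cong ; from-cong = g-cong
    ; inverse = (λ {x} y≈gx → trans (f-cong y≈gx) (fg≈id x)) , (λ {x} y≈fx → trans (g-cong y≈fx) (gf≈id x))
    })

  HasFixedPoint : (Carrier → Carrier) → Set (a Level.⊔ ℓa)
  HasFixedPoint f = ∃ λ x → f x ≈ x

  fixedPoint⇒ : ∀ {f g} → DynEquiv S f g → HasFixedPoint f → HasFixedPoint g
  fixedPoint⇒ (σ , σf≈gσ) (x , fx≈x) = Bijection.to σ x , trans (sym (σf≈gσ x)) (Bijection.cong σ fx≈x)

  fixedPoint⇐ : ∀ {f g} → (∀ {x y} → x ≈ y → g x ≈ g y) → DynEquiv S f g → HasFixedPoint g → HasFixedPoint f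
  fixedPoint⇐ {f} {g} g-cong (σ , σf≈gσ) (y , gy≈y) with Bijection.strictlySurjective σ y
  ... | x , σx≈y = x , Bijection.injective σ (begin
    to (f x)      ≈⟨ σf≈gσ x ⟩
    g (to x)      ≈⟨ g-cong σx≈y ⟩
    g y           ≈⟨ gy≈y ⟩
    y             ≈⟨ σx≈y ⟨
    to x          ∎)
    where
    open Bijection σ using (to)
    open import Relation.Binary.Reasoning.Setoid S

-- Normal forms and invariants of affine maps x ↦ a x + b over a field.
module AffineMaps {c ℓ} (F : CommutativeRing c ℓ) (isField : IsField F) where
  open CommutativeRing F
  open IsField isField using (inverse)
  open FieldTheory F isField
  open AffineSystems F
  open Dynamics setoid
  open import Algebra.Properties.CommutativeSemiring.Exp commutativeSemiring using (_^_)
  open import Algebra.Properties.Group +-group using (∙-cancelˡ; //-rightDividesˡ; //-rightDividesʳ; x∙y⁻¹≈ε⇒x≈y)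
  import Algebra.Properties.CommutativeSemigroup *-commutativeSemigroup as *-Props
  open import Relation.Binary.Reasoning.Setoid setoid

  ~-trans : ∀ {p p′ p″} → p ~ p′ → p′ ~ p″ → p ~ p″
  ~-trans {p} {p′} {p″} = dynEquiv-trans {f = affine p} {affine p′} {affine p″}

  scaling : ∀ a → Nonzero a → Param
  scaling a a≉0 = a , a≉0 , 0#

  translation : Param
  translation = 1# , 1≉0 , 1#

  affine-cong : ∀ p {x y} → x ≈ y → affine p x ≈ affine p y
  affine-cong _ x≈y = +-congʳ (*-congˡ x≈y)

  translation-normalForm : ∀ {a b} (a≉0 : Nonzero a) → a ≈ 1# → Nonzero b → (a , a≉0 , b) ~ translation
  translation-normalForm {a} {b} _ a≈1 b≉0 with inverse b b≉0
  ... | b⁻¹ , bb⁻¹≈1 = bijection (b⁻¹ *_) (b *_) *-congˡ *-congˡ b⁻¹b≈id bb⁻¹≈id , conj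
    where
    b⁻¹b≈id : ∀ y → b⁻¹ * (b * y) ≈ y
    b⁻¹b≈id y = trans (*-Props.x∙yz≈yx∙z b⁻¹ b y) (trans (*-congʳ bb⁻¹≈1) (*-identityˡ y))
    bb⁻¹≈id : ∀ x → b * (b⁻¹ * x) ≈ x
    bb⁻¹≈id x = trans (sym (*-assoc b b⁻¹ x)) (trans (*-congʳ bb⁻¹≈1) (*-identityˡ x))
    conj : ∀ x → b⁻¹ * (a * x + b) ≈ 1# * (b⁻¹ * x) + 1#
    conj x = begin
      b⁻¹ * (a * x + b)        ≈⟨ distribˡ b⁻¹ (a * x) b ⟩
      b⁻¹ * (a * x) + b⁻¹ * b  ≈⟨ +-cong (*-congˡ (trans (*-congʳ a≈1) (*-identityˡ x))) (trans (*-comm b⁻¹ b) bb⁻¹≈1) ⟩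
      b⁻¹ * x + 1#             ≈⟨ +-congʳ (*-identityˡ _) ⟨
      1# * (b⁻¹ * x) + 1#      ∎

  shiftConjugacy : ∀ {a b} (a≉0 : Nonzero a) c → b + c ≈ a * c → (a , a≉0 , b) ~ scaling a a≉0
  shiftConjugacy {a} {b} _ c b+c≈ac = bijection (_+ c) (_- c) +-congʳ +-congʳ (//-rightDividesˡ c) (//-rightDividesʳ c) , conj
    where
    conj : ∀ x → (a * x + b) + c ≈ a * (x + c) + 0#
    conj x = begin
      (a * x + b) + c    ≈⟨ +-assoc (a * x) b c ⟩
      a * x + (b + c)    ≈⟨ +-congˡ b+c≈ac ⟩
      a * x + a * c      ≈⟨ distribˡ a x c ⟨
      a * (x + c)        ≈⟨ +-identityʳ _ ⟨
      a * (x + c) + 0#   ∎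

  -- Such a shift exists unless x ↦ x + b is a translation with b ≠ 0:
  -- for a ≠ 1 take c = b (a - 1)⁻¹, for b ≈ 0 take c = 0.
  shiftExists : ∀ {a b} → (¬ a ≈ 1#) ⊎ (b ≈ 0#) → ∃ λ c → b + c ≈ a * c
  shiftExists {a} {b} (inj₂ b≈0) = 0# , trans (+-identityʳ b) (trans b≈0 (sym (zeroʳ a)))
  shiftExists {a} {b} (inj₁ a≉1) with inverse (a - 1#) (a≉1 ∘ x∙y⁻¹≈ε⇒x≈y a 1#)
  ... | v , [a-1]v≈1 = b * v , (begin
    b + b * v                        ≈⟨ +-cong b≈[a-1]bv (sym (*-identityˡ (b * v))) ⟩
    (a - 1#) * (b * v) + 1# * (b * v) ≈⟨ distribʳ (b * v) (a - 1#) 1# ⟨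
    ((a - 1#) + 1#) * (b * v)        ≈⟨ *-congʳ (//-rightDividesˡ 1# a) ⟩
    a * (b * v)                      ∎)
    where
    b≈[a-1]bv : b ≈ (a - 1#) * (b * v)
    b≈[a-1]bv = sym (trans (*-Props.x∙yz≈y∙xz (a - 1#) b v) (trans (*-congˡ [a-1]v≈1) (*-identityʳ b)))

  removeTranslation : ∀ {a b} (a≉0 : Nonzero a) → (¬ a ≈ 1#) ⊎ (b ≈ 0#) → (a , a≉0 , b) ~ scaling a a≉0
  removeTranslation a≉0 cases with shiftExists cases
  ... | c , b+c≈ac = shiftConjugacy a≉0 c b+c≈ac

  scaling-fixesZero : ∀ {a} (a≉0 : Nonzero a) → HasFixedPoint (affine (scaling a a≉0))
  scaling-fixesZero {a} _ = 0# , trans (+-identityʳ _) (zeroʳ a)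

  translation-noFixedPoint : ¬ HasFixedPoint (affine translation)
  translation-noFixedPoint (x , x+1≈x) = 1≉0 (∙-cancelˡ x 1# 0# (begin
    x + 1#        ≈⟨ +-congʳ (*-identityˡ x) ⟨
    1# * x + 1#   ≈⟨ x+1≈x ⟩
    x             ≈⟨ +-identityʳ x ⟨
    x + 0#        ∎))

  scaling≁translation : ∀ {a} (a≉0 : Nonzero a) → ¬ scaling a a≉0 ~ translation
  scaling≁translation a≉0 eq = translation-noFixedPoint (fixedPoint⇒ eq (scaling-fixesZero a≉0))

  translation≁scaling : ∀ {a} (a≉0 : Nonzero a) → ¬ translation ~ scaling a a≉0
  translation≁scaling a≉0 eq = translation-noFixedPoint (fixedPoint⇐ (affine-cong (scaling _ a≉0)) eq (scaling-fixesZero a≉0))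

  scaling-powers : ∀ {a a′} (a≉0 : Nonzero a) (a′≉0 : Nonzero a′) (eq : scaling a a≉0 ~ scaling a′ a′≉0) →
                   ∀ t x → Bijection.to (proj₁ eq) (a ^ t * x) ≈ a′ ^ t * Bijection.to (proj₁ eq) x
  scaling-powers _ _ (σ , σf≈gσ) zero x = trans (Bijection.cong σ (*-identityˡ x)) (sym (*-identityˡ _))
  scaling-powers {a} {a′} a≉0 a′≉0 eq@(σ , σf≈gσ) (suc t) x = begin
    to (a * a ^ t * x)          ≈⟨ Bijection.cong σ (trans (*-assoc a (a ^ t) x) (sym (+-identityʳ _))) ⟩
    to (a * (a ^ t * x) + 0#)   ≈⟨ σf≈gσ (a ^ t * x) ⟩
    a′ * to (a ^ t * x) + 0#    ≈⟨ +-identityʳ _ ⟩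
    a′ * to (a ^ t * x)         ≈⟨ *-congˡ (scaling-powers a≉0 a′≉0 eq t x) ⟩
    a′ * (a′ ^ t * to x)        ≈⟨ *-assoc a′ (a′ ^ t) (to x) ⟨
    a′ * a′ ^ t * to x          ∎
    where open Bijection σ using (to)

  -- Conjugate scalings have multipliers of the same order: a ^ t ≈ 1 iff the t-th
  -- iterate is the identity, and this is preserved by conjugacy (test it on σ⁻¹(1) and 1).
  scaling-order : ∀ {a a′ d d′} (a≉0 : Nonzero a) (a′≉0 : Nonzero a′) →
                  scaling a a≉0 ~ scaling a′ a′≉0 → IsOrder a d → IsOrder a′ d′ → d ≡ d′
  scaling-order {a} {a′} {d} {d′} a≉0 a′≉0 eq@(σ , _) oa oa′ = ∣-antisym d∣d′ d′∣d
    where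
    open Bijection σ using (to)
    powers : ∀ t x → to (a ^ t * x) ≈ a′ ^ t * to x
    powers = scaling-powers a≉0 a′≉0 eq
    d∣d′ : d ∣ d′
    d∣d′ = IsOrder.minimal oa d′ (trans (sym (*-identityʳ _)) (Bijection.injective σ (begin
      to (a ^ d′ * 1#)     ≈⟨ powers d′ 1# ⟩
      a′ ^ d′ * to 1#      ≈⟨ *-congʳ (IsOrder.root oa′) ⟩
      1# * to 1#           ≈⟨ *-identityˡ _ ⟩
      to 1#                ∎)))
    d′∣d : d′ ∣ d
    d′∣d with Bijection.strictlySurjective σ 1#
    ... | y , σy≈1 = IsOrder.minimal oa′ d (begin
      a′ ^ d               ≈⟨ *-identityʳ _ ⟨
      a′ ^ d * 1#          ≈⟨ *-congˡ σy≈1 ⟨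
      a′ ^ d * to y        ≈⟨ powers d y ⟨
      to (a ^ d * y)       ≈⟨ Bijection.cong σ (trans (*-congʳ (IsOrder.root oa)) (*-identityˡ y)) ⟩
      to y                 ≈⟨ σy≈1 ⟩
      1#                   ∎)

  module Classification (n : ℕ) (ι : HasOrder F (suc n)) where
    open FiniteField n ι
    open import Algebra.Properties.CommutativeSemiring.Exp commutativeSemiring using (^-congˡ; ^-assocʳ; ^-homo-*; ^-distrib-*)

    -- If α * w ≡ 1 (mod n) then x ↦ x ^ w is a bijection with inverse x ↦ x ^ α, because
    -- x ^ n ≈ 1 for x ≠ 0; it conjugates x ↦ a x to x ↦ a ^ w x.
    powerConjugacy : ∀ {a a′ w α β} (a≉0 : Nonzero a) (a′≉0 : Nonzero a′) → a ^ w ≈ a′ →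
                     α ℕ.* w ≡ 1 ℕ.+ β ℕ.* n → scaling a a≉0 ~ scaling a′ a′≉0
    powerConjugacy {a} {a′} {w} {α} {β} _ _ aʷ≈a′ αw≡ =
      bijection (_^ w) (_^ α) (^-congˡ w) (^-congˡ α)
        (powerInverse α w αw≡) (powerInverse w α (≡.trans (ℕ.*-comm w α) αw≡)) , conj
      where
      powerInverse : ∀ u v → u ℕ.* v ≡ 1 ℕ.+ β ℕ.* n → ∀ x → (x ^ u) ^ v ≈ x
      powerInverse u v uv≡ x with x ≟ 0#
      powerInverse zero    _       ()  x | yes _
      powerInverse (suc u) zero    uv≡ x | yes _ with () ← ≡.trans (≡.sym (ℕ.*-zeroʳ u)) uv≡
      powerInverse (suc u) (suc v) uv≡ x | yes x≈0 = begin
        (x ^ suc u) ^ suc v     ≈⟨ ^-congˡ (suc v) (trans (^-congˡ (suc u) x≈0) (zeroˡ _)) ⟩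
        0# ^ suc v              ≈⟨ zeroˡ _ ⟩
        0#                      ≈⟨ x≈0 ⟨
        x                       ∎
      powerInverse u v uv≡ x | no x≉0 = begin
        (x ^ u) ^ v             ≈⟨ ^-assocʳ x u v ⟩
        x ^ (u ℕ.* v)           ≡⟨ ≡.cong (x ^_) (≡.trans uv≡ (≡.cong suc (ℕ.*-comm β n))) ⟩
        x * x ^ (n ℕ.* β)       ≈⟨ *-congˡ (^-multiple n β (fermat x≉0)) ⟩
        x * 1#                  ≈⟨ *-identityʳ x ⟩
        x                       ∎
      conj : ∀ x → (a * x + 0#) ^ w ≈ a′ * x ^ w + 0#
      conj x = begin
        (a * x + 0#) ^ w        ≈⟨ ^-congˡ w (+-identityʳ _) ⟩
        (a * x) ^ w             ≈⟨ ^-distrib-* a x w ⟩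
        a ^ w * x ^ w           ≈⟨ *-congʳ aʷ≈a′ ⟩
        a′ * x ^ w              ≈⟨ +-identityʳ _ ⟨
        a′ * x ^ w + 0#         ∎

    -- Scalings whose multipliers have the same order d are conjugate: a′ ≈ a ^ k with k a
    -- unit modulo d, which lifts to a unit w ≡ k (mod d) modulo n, and a ^ w ≈ a ^ k.
    sameOrder⇒conjugate : ∀ {a a′ d} (a≉0 : Nonzero a) (a′≉0 : Nonzero a′) →
                          IsOrder a d → IsOrder a′ d → scaling a a≉0 ~ scaling a′ a′≉0
    sameOrder⇒conjugate {a} {a′} {d} a≉0 a′≉0 oa oa′ with sameOrder⇒power oa oa′
    ... | k , aᵏ≈a′ , k⊥d with unitLift n≢0 (order∣n oa) k⊥d
    ...   | _ , (u , ≡.refl) , α , β , αw≡ = powerConjugacy {w = k ℕ.+ d ℕ.* u} {α} {β} a≉0 a′≉0 aʷ≈a′ αw≡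
      where
      aʷ≈a′ : a ^ (k ℕ.+ d ℕ.* u) ≈ a′
      aʷ≈a′ = begin
        a ^ (k ℕ.+ d ℕ.* u)       ≈⟨ ^-homo-* a k (d ℕ.* u) ⟩
        a ^ k * a ^ (d ℕ.* u)     ≈⟨ *-cong aᵏ≈a′ (^-multiple d u (IsOrder.root oa)) ⟩
        a′ * 1#                   ≈⟨ *-identityʳ a′ ⟩
        a′                        ∎

    divisors : List ℕ
    divisors = filter (_∣? n) (map suc (upTo n))

    divisor : Fin (τ n) → ℕ
    divisor = lookup divisors

    divisor∣n : ∀ i → divisor i ∣ n
    divisor∣n i = All.lookup (all-filter (_∣? n) (map suc (upTo n))) (∈-lookup i)

    divisor-injective : ∀ i j → divisor i ≡ divisor j → i ≡ j
    divisor-injective = lookup-injective (Unique.filter⁺ (_∣? n) (Unique.map⁺ ℕ.suc-injective (Unique.upTo⁺ n)))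

    divisor-surjective : ∀ {d} → d ∣ n → ∃ λ i → divisor i ≡ d
    divisor-surjective {zero}  0∣n = ⊥-elim (n≢0 (0∣⇒≡0 0∣n))
    divisor-surjective {suc d} d∣n = Any.index d∈divisors , ≡.sym (lookup-index d∈divisors)
      where
      d∈divisors : suc d ∈ divisors
      d∈divisors = ∈-filter⁺ (_∣? n) (∈-map⁺ suc (∈-upTo⁺ (∣⇒≤ {{ℕ.≢-nonZero n≢0}} d∣n))) d∣n

    elementOfDivisor : Fin (τ n) → Carrier
    elementOfDivisor i = proj₁ (elementOfOrder (divisor∣n i))

    elementOfDivisor-order : ∀ i → IsOrder (elementOfDivisor i) (divisor i)
    elementOfDivisor-order i = proj₂ (elementOfOrder (divisor∣n i))

    elementOfDivisor-nonzero : ∀ i → Nonzero (elementOfDivisor i)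
    elementOfDivisor-nonzero i = order⇒nonzero (elementOfDivisor-order i)

    representative : Fin (τ n) ⊎ Fin 1 → Param
    representative (inj₁ i) = scaling (elementOfDivisor i) (elementOfDivisor-nonzero i)
    representative (inj₂ _) = translation

    representative-injective : ∀ s t → representative s ~ representative t → s ≡ t
    representative-injective (inj₁ i) (inj₁ j) eq =
      ≡.cong inj₁ (divisor-injective i j (scaling-order (elementOfDivisor-nonzero i) (elementOfDivisor-nonzero j) eq
        (elementOfDivisor-order i) (elementOfDivisor-order j)))
    representative-injective (inj₁ i) (inj₂ _) eq = ⊥-elim (scaling≁translation (elementOfDivisor-nonzero i) eq)
    representative-injective (inj₂ _) (inj₁ j) eq = ⊥-elim (translation≁scaling (elementOfDivisor-nonzero j) eq)
    representative-injective (inj₂ Fin.zero) (inj₂ Fin.zero) _ = ≡.refl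

    scaling-representative : ∀ {a} (a≉0 : Nonzero a) → ∃ λ s → scaling a a≉0 ~ representative s
    scaling-representative a≉0 with orderExists a≉0
    ... | d , oa with divisor-surjective (order∣n oa)
    ...   | i , ≡.refl = inj₁ i , sameOrder⇒conjugate a≉0 (elementOfDivisor-nonzero i) oa (elementOfDivisor-order i)

    nonTranslation-representative : ∀ {a b} (a≉0 : Nonzero a) → (¬ a ≈ 1#) ⊎ (b ≈ 0#) →
                                    ∃ λ s → (a , a≉0 , b) ~ representative s
    nonTranslation-representative {a} {b} a≉0 cases with scaling-representative a≉0
    ... | s , eq = s , ~-trans {a , a≉0 , b} {scaling a a≉0} {representative s} (removeTranslation a≉0 cases) eq

    representative-cover : ∀ p → ∃ λ s → p ~ representative s
    representative-cover (a , a≉0 , b) with a ≟ 1# | b ≟ 0#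
    ... | yes a≈1 | no b≉0  = inj₂ Fin.zero , translation-normalForm a≉0 a≈1 b≉0
    ... | no a≉1  | _       = nonTranslation-representative a≉0 (inj₁ a≉1)
    ... | yes _   | yes b≈0 = nonTranslation-representative a≉0 (inj₂ b≈0)

    classification : HasNClasses Param _~_ (τ n ℕ.+ 1)
    classification = hasNClasses-⊎ {_~_ = _~_} representative representative-injective representative-cover

-- A field of order q has an element, so q = n + 1, and the classification applies.
theorem3p4 : ∀ {c ℓ : Level} (q : ℕ) → (∃₂ λ p k → Prime p × k ℕ.≥ 1 × q ≡ p ℕ.^ k)
    → (F : CommutativeRing c ℓ) → IsField F → HasOrder F q
    → HasNClasses (AffineSystems.Param F) (AffineSystems._~_ F) (τ (q ℕ.∸ 1) ℕ.+ 1)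
theorem3p4 zero    _ F _       ι with Inverse.to ι (CommutativeRing.0# F)
... | ()
theorem3p4 (suc n) _ F isField ι = AffineMaps.Classification.classification F isField n ι
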